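{- Let $p$ be a prime, $n$ a positive integer, and $f:\mathbb{F}_{p^n}\to\mathbb{F}_p$ a partially bent function; let $s$ be the dimension (over $\mathbb{F}_p$) of the linear space of $f$, so that $f$ is $s$-plateaued. Let $G_f=\{(x,f(x)):x\in\mathbb{F}_{p^n}\}$. Then the incidence structure whose points are the elements of $\mathbb{F}_{p^n}\times\mathbb{F}_p$ and whose blocks are the distinct translates $(u,v)+G_f$, $(u,v)\in\mathbb{F}_{p^n}\times\mathbb{F}_p$, is a partial geometric design with parameters $v=p^{n+1}$, $b=p^{n+1-s}$, $k=p^n$, $r=p^{n-s}$, $\alpha=p^{2n-1-s}-p^{n-1}$, $\beta=p^n+p^{2n-1-s}-p^{n-1}$.
   Context: $f$ is partially bent if for every $a\in\mathbb{F}_{p^n}$ the derivative $D_af(x)=f(x+a)-f(x)$ is either balanced (takes each value of $\mathbb{F}_p$ exactly $p^{n-1}$ times) or constant. The linear space of $f$ is the set of $a$ for which $D_af$ is constant. $f$ is $s$-plateaued if $|\widehat f(\mu)|\in\{0,p^{(n+s)/2}\}$ for all $\mu$, where $\widehat f(\mu)=\sum_x e^{2\pi i(f(x)-Tr_n(\mu x))/p}$. A partial geometric design with parameters $(v,b,k,r;\alpha,\beta)$ is an incidence structure with $v$ points and $b$ blocks, each block containing $k$ points and each point lying in $r$ blocks, such that for each point $x$ and block $B$, the number of pairs $(y,C)$ with $y$ a point of $B$, $C$ a block, and $x,y\in C$ equals $\alpha$ if $x\notin B$ and $\beta$ if $x\in B$ (equivalently, its incidence matrix $N$ satisfies $NN^{T}N=(\beta-\alpha)N+\alpha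 J$). -}

module Defs where

open import Data.Nat using (ℕ; zero; suc; _+_; _*_; _∸_; NonZero)
open import Data.Nat.DivMod using (_mod_)
open import Data.Fin using (Fin; toℕ)
import Data.Fin as F
open import Data.Vec using (Vec; []; _∷_; zipWith; map)
import Data.Vec.Properties as VP
open import Data.List using (List; []; _∷_; [_]; concatMap; allFin)
open import Data.Nat.ListAction using (sum)
import Data.List as L
open import Data.Bool using (Bool; true; false; if_then_else_)
open import Data.Product using (_×_; _,_; Σ; ∃)
open import Data.Sum using (_⊎_)
open import Relation.Binary.PropositionalEquality using (_≡_; _≢_)
open import Relation.Nullary using (¬_)
open import Relation.Nullary.Decidable using (⌊_⌋)

count : {A : Set} → (A → Bool) → List A → ℕ
count P []       = 0
count P (x ∷ xs) = if P x then suc (count P xs) else count P xs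

sumOver : {A : Set} → List A → (A → ℕ) → ℕ
sumOver xs g = sum (L.map g xs)

module _ (p : ℕ) .{{_ : NonZero p}} where

  Fp : Set
  Fp = Fin p

  _+ₚ_ : Fp → Fp → Fp
  a +ₚ b = (toℕ a + toℕ b) mod p

  _-ₚ_ : Fp → Fp → Fp
  a -ₚ b = (toℕ a + (p ∸ toℕ b)) mod p

  _*ₚ_ : Fp → Fp → Fp
  a *ₚ b = (toℕ a * toℕ b) mod p

  zeroₚ : Fp
  zeroₚ = 0 mod p

  -- The additive group / F_p-vector space of F_{p^n}, identified with F_p^n
  -- via a choice of F_p-basis.
  V : ℕ → Set
  V n = Vec Fp n

  _+ᵥ_ : ∀ {n} → V n → V n → V n
  _+ᵥ_ = zipWith _+ₚ_

  _-ᵥ_ : ∀ {n} → V n → V n → V n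
  _-ᵥ_ = zipWith _-ₚ_

  _•_ : ∀ {n} → Fp → V n → V n
  c • x = map (c *ₚ_) x

  zeroᵥ : ∀ n → V n
  zeroᵥ n = Data.Vec.replicate n zeroₚ

  allV : ∀ n → List (V n)
  allV zero    = [ [] ]
  allV (suc n) = concatMap (λ a → L.map (a ∷_) (allV n)) (allFin p)

  lincomb : ∀ {n} s → (Fin s → Fp) → (Fin s → V n) → V n
  lincomb {n} zero    c b = zeroᵥ n
  lincomb {n} (suc s) c b = (c F.zero • b F.zero) +ᵥ lincomb s (λ i → c (F.suc i)) (λ i → b (F.suc i))

  D : ∀ {n} → (V n → Fp) → V n → V n → Fp
  D f a x = f (x +ᵥ a) -ₚ f x

  Balanced : ∀ n → (V n → Fp) → Set
  Balanced n g = (c : Fp) → count (λ x → ⌊ g x F.≟ c ⌋) (allV n) ≡ p Data.Nat.^ (n ∸ 1)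

  Constant : ∀ {n} → (V n → Fp) → Set
  Constant g = Σ Fp λ c → ∀ x → g x ≡ c

  PartiallyBent : ∀ n → (V n → Fp) → Set
  PartiallyBent n f = (a : V n) → Balanced n (D f a) ⊎ Constant (D f a)

  InLinearSpace : ∀ {n} → (V n → Fp) → V n → Set
  InLinearSpace f a = Constant (D f a)

  -- the linear space of f has F_p-dimension s: it has a basis of s vectors,
  -- i.e. the map c ↦ Σ c_i b_i is a bijection from F_p^s onto the linear space.
  LinearSpaceDim : ∀ n → (V n → Fp) → ℕ → Set
  LinearSpaceDim n f s =
    Σ (Fin s → V n) λ b →
      ((c : Fin s → Fp) → InLinearSpace f (lincomb s c b))
    × ((a : V n) → InLinearSpace f a → Σ (Fin s → Fp) λ c → lincomb s c b ≡ a)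
    × ((c c′ : Fin s → Fp) → lincomb s c b ≡ lincomb s c′ b → (i : Fin s) → c i ≡ c′ i)

  Point : ℕ → Set
  Point n = V n × Fp

  allPoints : ∀ n → List (Point n)
  allPoints n = concatMap (λ x → L.map (x ,_) (allFin p)) (allV n)

  inTranslate : ∀ {n} → (V n → Fp) → Point n → Point n → Bool
  inTranslate f (u , v) (x , y) = ⌊ y F.≟ (f (x -ᵥ u) +ₚ v) ⌋

  SameBlock : ∀ {n} → (V n → Fp) → Point n → Point n → Set
  SameBlock f t t′ = ∀ z → inTranslate f t z ≡ inTranslate f t′ z

  EnumeratesTranslates : ∀ {n} → (V n → Fp) → (b : ℕ) → (Fin b → Point n) → Set
  EnumeratesTranslates f b rep =
      ((i j : Fin b) → SameBlock f (rep i) (rep j) → i ≡ j)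
    × ((t : Point _) → Σ (Fin b) λ i → SameBlock f t (rep i))

  IsPGD : ∀ n → (V n → Fp) → (b : ℕ) → (Fin b → Point n) → (v k r α β : ℕ) → Set
  IsPGD n f b rep v k r α β =
      L.length (allPoints n) ≡ v
    × ((i : Fin b) → count (inTranslate f (rep i)) (allPoints n) ≡ k)
    × ((x : Point n) → count (λ i → inTranslate f (rep i) x) (allFin b) ≡ r)
    × ((x : Point n) (i : Fin b) →
         let N = sumOver (allPoints n) λ y →
                   if inTranslate f (rep i) y
                   then count (λ j → if inTranslate f (rep j) x then inTranslate f (rep j) y else false) (allFin b)
                   else 0
         in (inTranslate f (rep i) x ≡ false → N ≡ α)
          × (inTranslate f (rep i) x ≡ true → N ≡ β))

-- Write t = (u , v) for the translate (u , v) + G_f, i.e. the graph of x ↦ f (x - u) + v.  The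
-- translates t + r and r are the same block iff D_a f is constantly c, where t = (a , c); hence each
-- block is named by exactly |L| = p^s translates (L the linear space of f).  Taking the first
-- translate of each class in an enumeration of all translates gives p^(n+1-s) distinct blocks, and a
-- sum of a block function over these blocks is 1/p^s times its sum over all translates.  Over all
-- translates everything is explicit: a translate has p^n points, a point lies on p^n translates, and
-- for a translate t₀ and a point z the sum of |t₀ ∩ t| over the translates t through z becomes, after
-- the change of variables u = u₀ - a, a sum over a of the agreements of f with its translate by a:
-- p^n·[z ∈ t₀] for a ∈ L, and p^(n-1) for a ∉ L, where D_a f is balanced.  Dividing by p^s yields
-- k, r, α and β.
module Submission where

open import Defs
open import Data.Nat using (ℕ; _+_; _*_; _∸_; _^_; _≤_; NonZero)
open import Data.Nat.Primality using (Prime)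
open import Data.Fin using (Fin)
open import Data.Product using (Σ; _×_)

open import Data.Bool using (Bool; true; false; if_then_else_)
import Data.Bool as Bool
open import Data.Empty using (⊥-elim)
open import Data.Fin using (toℕ)
import Data.Fin as F
import Data.Fin.Properties as FP
open import Data.List using (List; []; _∷_; _++_; length; concatMap; cartesianProductWith; allFin; lookup; filter)
import Data.List as L
import Data.List.Properties as LP
open import Data.List.Membership.Propositional using (_∈_)
open import Data.List.Membership.Propositional.Properties
  using (∈-lookup; ∈-filter⁺; ∈-filter⁻; ∈-allFin; ∈-cartesianProductWith⁺)
open import Data.List.Relation.Unary.All using (All; []; _∷_)
import Data.List.Relation.Unary.All as All
open import Data.List.Relation.Unary.Any using (here; there)
import Data.List.Relation.Unary.Any as Any
open import Data.List.Relation.Unary.Any.Properties using (lookup-index)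
open import Data.List.Relation.Unary.Unique.Propositional using (Unique; []; _∷_)
import Data.List.Relation.Unary.Unique.Propositional.Properties as Unique
open import Data.Nat using (zero; suc; z≤n; s≤s; _<_)
open import Data.Nat.Base using (nonTrivial⇒n>1)
open import Data.Nat.DivMod using (_mod_; _%_; %-distribˡ-+; m%n%n≡m%n; [m+n]%n≡m%n; m<n⇒m%n≡m; m%n<n)
open import Data.Nat.ListAction using (sum)
open import Data.Nat.ListAction.Properties using (sum-++)
open import Data.Nat.Primality using (prime⇒nonTrivial)
open import Data.Nat.Properties
open import Data.Nat.Tactic.RingSolver using (solve-∀)
open import Data.Product using (_,_; proj₁; proj₂)
import Data.Product.Properties as ×P
open import Data.Sum using (inj₁; inj₂)
open import Data.Vec using ([]; _∷_)
import Data.Vec as Vec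
import Data.Vec.Properties as VecP
open import Level using (0ℓ)
open import Relation.Binary.Core using (Rel)
open import Relation.Binary.Definitions using (DecidableEquality; Decidable; Reflexive; Symmetric; Transitive)
open import Relation.Binary.PropositionalEquality
open import Relation.Nullary using (Dec; yes; no; ¬_)
open import Relation.Nullary.Decidable using (⌊_⌋)
import Relation.Unary as U

ind : Bool → ℕ
ind b = if b then 1 else 0

ind-* : ∀ b X → ind b * X ≡ (if b then X else 0)
ind-* false X = refl
ind-* true  X = +-identityʳ X

does-cong : ∀ {P Q : Set} → (P → Q) → (Q → P) → (p? : Dec P) (q? : Dec Q) → ⌊ p? ⌋ ≡ ⌊ q? ⌋
does-cong f g (yes p) (yes q) = refl
does-cong f g (yes p) (no ¬q) = ⊥-elim (¬q (f p))
does-cong f g (no ¬p) (yes q) = ⊥-elim (¬p (g q))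
does-cong f g (no ¬p) (no ¬q) = refl

ind-∧ : ∀ a b → ind (if a then b else false) ≡ ind a * ind b
ind-∧ false b = refl
ind-∧ true  b = sym (+-identityʳ (ind b))

⌊⌋-true : ∀ {P : Set} (p? : Dec P) → P → ⌊ p? ⌋ ≡ true
⌊⌋-true (yes _) _ = refl
⌊⌋-true (no ¬p) p = ⊥-elim (¬p p)

⌊⌋-sound : ∀ {P : Set} (p? : Dec P) → ⌊ p? ⌋ ≡ true → P
⌊⌋-sound (yes p) _  = p
⌊⌋-sound (no _)  ()

⌊⌋-false : ∀ {P : Set} (p? : Dec P) → ¬ P → ⌊ p? ⌋ ≡ false
⌊⌋-false (yes p) ¬p = ⊥-elim (¬p p)
⌊⌋-false (no _)  _  = refl

module _ {A : Set} where

  sumOver-cong : (xs : List A) {g h : A → ℕ} → (∀ x → g x ≡ h x) → sumOver xs g ≡ sumOver xs h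
  sumOver-cong xs e = cong sum (LP.map-cong e xs)

  sumOver-++ : (xs ys : List A) (g : A → ℕ) → sumOver (xs ++ ys) g ≡ sumOver xs g + sumOver ys g
  sumOver-++ xs ys g = trans (cong sum (LP.map-++ g xs ys)) (sum-++ (L.map g xs) (L.map g ys))

  sumOver-+ : (xs : List A) (g h : A → ℕ) → sumOver xs (λ x → g x + h x) ≡ sumOver xs g + sumOver xs h
  sumOver-+ []       g h = refl
  sumOver-+ (x ∷ xs) g h = trans (cong (g x + h x +_) (sumOver-+ xs g h)) (interchange (g x) (h x) _ _)
    where
      interchange : ∀ a b c d → a + b + (c + d) ≡ a + c + (b + d)
      interchange = solve-∀

  sumOver-scale : (xs : List A) (c : ℕ) (g : A → ℕ) → sumOver xs (λ x → c * g x) ≡ c * sumOver xs g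
  sumOver-scale []       c g = sym (*-zeroʳ c)
  sumOver-scale (x ∷ xs) c g = trans (cong (c * g x +_) (sumOver-scale xs c g)) (sym (*-distribˡ-+ c (g x) _))

  sumOver-const : (xs : List A) (c : ℕ) → sumOver xs (λ _ → c) ≡ length xs * c
  sumOver-const []       c = refl
  sumOver-const (x ∷ xs) c = cong (c +_) (sumOver-const xs c)

  length≡sumOver : (xs : List A) → length xs ≡ sumOver xs (λ _ → 1)
  length≡sumOver xs = sym (trans (sumOver-const xs 1) (*-identityʳ _))

  sumOver-zero : (xs : List A) {g : A → ℕ} → (∀ x → g x ≡ 0) → sumOver xs g ≡ 0
  sumOver-zero xs e = trans (sumOver-cong xs e) (trans (sumOver-const xs 0) (*-zeroʳ (length xs)))

  count≡sumOver : (P : A → Bool) (xs : List A) → count P xs ≡ sumOver xs (λ x → ind (P x))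
  count≡sumOver P []       = refl
  count≡sumOver P (x ∷ xs) with P x
  ... | true  = cong suc (count≡sumOver P xs)
  ... | false = count≡sumOver P xs

  count≤length : (P : A → Bool) (xs : List A) → count P xs ≤ length xs
  count≤length P []       = z≤n
  count≤length P (x ∷ xs) with P x
  ... | true  = s≤s (count≤length P xs)
  ... | false = m≤n⇒m≤1+n (count≤length P xs)

  sumOver-if : (xs : List A) (P : A → Bool) (X Y : ℕ) →
    sumOver xs (λ x → if P x then X else Y) ≡ count P xs * X + (length xs ∸ count P xs) * Y
  sumOver-if []       P X Y = refl
  sumOver-if (x ∷ xs) P X Y with P x
  ... | true  rewrite sumOver-if xs P X Y = sym (+-assoc X _ _)
  ... | false rewrite sumOver-if xs P X Y | +-∸-assoc 1 (count≤length P xs) =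
    shuffle Y (count P xs * X) ((length xs ∸ count P xs) * Y)
    where
      shuffle : ∀ y a b → y + (a + b) ≡ a + (y + b)
      shuffle = solve-∀

  sumOver-select : (xs : List A) (P : A → Bool) (X : ℕ) → sumOver xs (λ x → if P x then X else 0) ≡ count P xs * X
  sumOver-select xs P X = trans (sumOver-if xs P X 0) (trans (cong (count P xs * X +_) (*-zeroʳ (length xs ∸ count P xs))) (+-identityʳ _))

  sumOver-filter : {P : A → Set} (P? : U.Decidable P) (xs : List A) (g : A → ℕ) →
    sumOver (filter P? xs) g ≡ sumOver xs (λ x → if ⌊ P? x ⌋ then g x else 0)
  sumOver-filter P? []       g = refl
  sumOver-filter P? (x ∷ xs) g with P? x
  ... | yes _ = cong (g x +_) (sumOver-filter P? xs g)
  ... | no  _ = sumOver-filter P? xs g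

  sumOver-lookup : (xs : List A) (g : A → ℕ) → sumOver (allFin (length xs)) (λ i → g (lookup xs i)) ≡ sumOver xs g
  sumOver-lookup xs g = cong sum (begin
    L.map (λ i → g (lookup xs i)) (allFin (length xs)) ≡⟨ LP.map-tabulate (λ i → i) (λ i → g (lookup xs i)) ⟩
    L.tabulate (λ i → g (lookup xs i))                 ≡⟨ LP.map-tabulate (lookup xs) g ⟨
    L.map g (L.tabulate (lookup xs))                   ≡⟨ cong (L.map g) (LP.tabulate-lookup xs) ⟩
    L.map g xs                                         ∎)
    where open ≡-Reasoning

module _ {A B : Set} where

  sumOver-map : (k : A → B) (xs : List A) (g : B → ℕ) → sumOver (L.map k xs) g ≡ sumOver xs (λ x → g (k x))
  sumOver-map k xs g = cong sum (sym (LP.map-∘ xs))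

  sumOver-swap : (xs : List A) (ys : List B) (g : A → B → ℕ) →
    sumOver xs (λ x → sumOver ys (g x)) ≡ sumOver ys (λ y → sumOver xs (λ x → g x y))
  sumOver-swap []       ys g = sym (trans (sumOver-const ys 0) (*-zeroʳ (length ys)))
  sumOver-swap (x ∷ xs) ys g = trans (cong (sumOver ys (g x) +_) (sumOver-swap xs ys g)) (sym (sumOver-+ ys (g x) _))

module _ {A B C : Set} (h : A → B → C) where

  concatMap≡cartesianProductWith : (xs : List A) (ys : List B) →
    concatMap (λ a → L.map (h a) ys) xs ≡ cartesianProductWith h xs ys
  concatMap≡cartesianProductWith []       ys = refl
  concatMap≡cartesianProductWith (x ∷ xs) ys = cong (L.map (h x) ys ++_) (concatMap≡cartesianProductWith xs ys)

  sumOver-product : (xs : List A) (ys : List B) (g : C → ℕ) →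
    sumOver (cartesianProductWith h xs ys) g ≡ sumOver xs (λ a → sumOver ys (λ b → g (h a b)))
  sumOver-product []       ys g = refl
  sumOver-product (x ∷ xs) ys g = trans (sumOver-++ (L.map (h x) ys) _ g)
    (cong₂ _+_ (sumOver-map (h x) ys g) (sumOver-product xs ys g))

  length-product : (xs : List A) (ys : List B) → length (cartesianProductWith h xs ys) ≡ length xs * length ys
  length-product xs ys = begin
    length (cartesianProductWith h xs ys)            ≡⟨ length≡sumOver (cartesianProductWith h xs ys) ⟩
    sumOver (cartesianProductWith h xs ys) (λ _ → 1) ≡⟨ sumOver-product xs ys (λ _ → 1) ⟩
    sumOver xs (λ _ → sumOver ys (λ _ → 1))          ≡⟨ sumOver-const xs _ ⟩
    length xs * sumOver ys (λ _ → 1)                 ≡⟨ cong (length xs *_) (length≡sumOver ys) ⟨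
    length xs * length ys                            ∎
    where open ≡-Reasoning

lookup-injective : {A : Set} {xs : List A} → Unique xs → ∀ i j → lookup xs i ≡ lookup xs j → i ≡ j
lookup-injective {xs = x ∷ xs} (x∉ ∷ u) F.zero    F.zero    e = refl
lookup-injective {xs = x ∷ xs} (x∉ ∷ u) F.zero    (F.suc j) e = ⊥-elim (All.lookup x∉ (∈-lookup j) e)
lookup-injective {xs = x ∷ xs} (x∉ ∷ u) (F.suc i) F.zero    e = ⊥-elim (All.lookup x∉ (∈-lookup i) (sym e))
lookup-injective {xs = x ∷ xs} (x∉ ∷ u) (F.suc i) (F.suc j) e = cong F.suc (lookup-injective u i j e)

module Enumeration {A : Set} (_≟_ : DecidableEquality A) where

  IsEnumeration : List A → Set
  IsEnumeration xs = Unique xs × (∀ a → a ∈ xs)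

  sumOver-absent : ∀ {c} (xs : List A) (h : A → ℕ) → All (c ≢_) xs →
    sumOver xs (λ x → if ⌊ x ≟ c ⌋ then h x else 0) ≡ 0
  sumOver-absent []       h []           = refl
  sumOver-absent {c} (x ∷ xs) h (c≢x ∷ c∉xs) with x ≟ c
  ... | yes x≡c = ⊥-elim (c≢x (sym x≡c))
  ... | no  _   = sumOver-absent xs h c∉xs

  sumOver-point : ∀ {c} (xs : List A) (h : A → ℕ) → Unique xs → c ∈ xs →
    sumOver xs (λ x → if ⌊ x ≟ c ⌋ then h x else 0) ≡ h c
  sumOver-point (x ∷ xs) h (x∉ ∷ u) (here refl) with x ≟ x
  ... | yes _  = trans (cong (h x +_) (sumOver-absent xs h x∉)) (+-identityʳ (h x))
  ... | no x≢x = ⊥-elim (x≢x refl)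
  sumOver-point {c} (x ∷ xs) h (x∉ ∷ u) (there c∈xs) with x ≟ c
  ... | yes x≡c = ⊥-elim (All.lookup x∉ c∈xs x≡c)
  ... | no  _   = sumOver-point xs h u c∈xs

  pick : ∀ {xs} → IsEnumeration xs → ∀ c (h : A → ℕ) → sumOver xs (λ x → if ⌊ x ≟ c ⌋ then h x else 0) ≡ h c
  pick {xs} (u , every) c h = sumOver-point xs h u (every c)

  decide-∀ : ∀ {xs} → IsEnumeration xs → {P : A → Set} → U.Decidable P → Dec (∀ x → P x)
  decide-∀ {xs} (_ , every) P? with All.all? P? xs
  ... | yes all = yes (λ x → All.lookup all (every x))
  ... | no ¬all = no (λ h → ¬all (All.tabulate (λ {x} _ → h x)))

  sumOver-bijection : ∀ {xs} → IsEnumeration xs → (σ τ : A → A) → (∀ a → τ (σ a) ≡ a) → (∀ b → σ (τ b) ≡ b) →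
    (g : A → ℕ) → sumOver xs (λ a → g (σ a)) ≡ sumOver xs g
  sumOver-bijection {xs} e σ τ τσ στ g = begin
    sumOver xs (λ a → g (σ a))
      ≡⟨ sumOver-cong xs (λ a → pick e (σ a) g) ⟨
    sumOver xs (λ a → sumOver xs (λ b → if ⌊ b ≟ σ a ⌋ then g b else 0))
      ≡⟨ sumOver-swap xs xs _ ⟩
    sumOver xs (λ b → sumOver xs (λ a → if ⌊ b ≟ σ a ⌋ then g b else 0))
      ≡⟨ sumOver-cong xs (λ b → sumOver-cong xs (λ a → cong (λ t → if t then g b else 0) (inverse b a))) ⟩
    sumOver xs (λ b → sumOver xs (λ a → if ⌊ a ≟ τ b ⌋ then g b else 0))
      ≡⟨ sumOver-cong xs (λ b → pick e (τ b) (λ _ → g b)) ⟩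
    sumOver xs g ∎
    where
      open ≡-Reasoning
      inverse : ∀ b a → ⌊ b ≟ σ a ⌋ ≡ ⌊ a ≟ τ b ⌋
      inverse b a = does-cong (λ b≡σa → trans (sym (τσ a)) (cong τ (sym b≡σa)))
                              (λ a≡τb → trans (sym (στ b)) (cong σ (sym a≡τb))) (b ≟ σ a) (a ≟ τ b)

module _ {A B : Set} (_≟A_ : DecidableEquality A) (_≟B_ : DecidableEquality B) where
  open Enumeration

  count-image : ∀ {xs ys} → IsEnumeration _≟A_ xs → IsEnumeration _≟B_ ys →
    {Q : B → Set} (Q? : U.Decidable Q) (h : A → B) → (∀ a a' → h a ≡ h a' → a ≡ a') →
    (∀ a → Q (h a)) → (∀ b → Q b → Σ A λ a → h a ≡ b) → count (λ b → ⌊ Q? b ⌋) ys ≡ length xs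
  count-image {xs} {ys} ex ey {Q} Q? h inj into onto = begin
    count (λ b → ⌊ Q? b ⌋) ys
      ≡⟨ count≡sumOver _ ys ⟩
    sumOver ys (λ b → ind ⌊ Q? b ⌋)
      ≡⟨ sumOver-cong ys fibre ⟩
    sumOver ys (λ b → sumOver xs (λ a → if ⌊ b ≟B h a ⌋ then 1 else 0))
      ≡⟨ sumOver-swap xs ys _ ⟨
    sumOver xs (λ a → sumOver ys (λ b → if ⌊ b ≟B h a ⌋ then 1 else 0))
      ≡⟨ sumOver-cong xs (λ a → pick _≟B_ ey (h a) (λ _ → 1)) ⟩
    sumOver xs (λ _ → 1)
      ≡⟨ length≡sumOver xs ⟨
    length xs ∎
    where
      open ≡-Reasoning
      -- the fibre of h over b has one element if Q b holds and none otherwise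
      fibre : ∀ b → ind ⌊ Q? b ⌋ ≡ sumOver xs (λ a → if ⌊ b ≟B h a ⌋ then 1 else 0)
      fibre b with Q? b
      ... | yes q = let (a₀ , ha₀≡b) = onto b q in sym (trans
              (sumOver-cong xs (λ a → cong (λ t → if t then 1 else 0)
                 (does-cong (λ b≡ha → inj a a₀ (trans (sym b≡ha) (sym ha₀≡b)))
                            (λ a≡a₀ → trans (sym ha₀≡b) (cong h (sym a≡a₀))) (b ≟B h a) (a ≟A a₀))))
              (pick _≟A_ ex a₀ (λ _ → 1)))
      ... | no ¬q = sym (sumOver-zero xs (λ a → cong (λ t → if t then 1 else 0)
              (⌊⌋-false (b ≟B h a) (λ b≡ha → ¬q (subst Q (sym b≡ha) (into a))))))

module Classes {A : Set} (_≟_ : DecidableEquality A) {xs : List A} (enum : Enumeration.IsEnumeration _≟_ xs)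
  {_~_ : Rel A 0ℓ} (_~?_ : Decidable _~_)
  (~-refl : Reflexive _~_) (~-sym : Symmetric _~_) (~-trans : Transitive _~_) where

  open Enumeration _≟_

  -- The first element of a list lying in the class of t (t itself if there is none).
  firstIn : A → List A → A
  firstIn t []       = t
  firstIn t (r ∷ rs) with r ~? t
  ... | yes _ = r
  ... | no  _ = firstIn t rs

  firstIn-~ : ∀ {t} rs → Any.Any (_~ t) rs → firstIn t rs ~ t
  firstIn-~ {t} (r ∷ rs) meets with r ~? t
  firstIn-~ (r ∷ rs) meets          | yes r~t = r~t
  firstIn-~ (r ∷ rs) (here r~t)     | no ¬r~t = ⊥-elim (¬r~t r~t)
  firstIn-~ (r ∷ rs) (there meets)  | no _    = firstIn-~ rs meets

  firstIn-cong : ∀ {t t'} → t ~ t' → ∀ rs → Any.Any (_~ t) rs → firstIn t rs ≡ firstIn t' rs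
  firstIn-cong {t} {t'} t~t' (r ∷ rs) meets with r ~? t | r ~? t'
  ... | yes _   | yes _    = refl
  ... | yes r~t | no ¬r~t' = ⊥-elim (¬r~t' (~-trans r~t t~t'))
  ... | no ¬r~t | yes r~t' = ⊥-elim (¬r~t (~-trans r~t' (~-sym t~t')))
  firstIn-cong t~t' (r ∷ rs) (here r~t)    | no ¬r~t | no _ = ⊥-elim (¬r~t r~t)
  firstIn-cong t~t' (r ∷ rs) (there meets) | no _    | no _ = firstIn-cong t~t' rs meets

  meets-xs : ∀ t → Any.Any (_~ t) xs
  meets-xs t = Any.map (λ t≡x → subst (_~ t) t≡x ~-refl) (proj₂ enum t)

  canon : A → A
  canon t = firstIn t xs

  canon-~ : ∀ t → canon t ~ t
  canon-~ t = firstIn-~ xs (meets-xs t)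

  canon-cong : ∀ {t t'} → t ~ t' → canon t ≡ canon t'
  canon-cong {t} t~t' = firstIn-cong t~t' xs (meets-xs t)

  canon-idem : ∀ t → canon (canon t) ≡ canon t
  canon-idem t = canon-cong (canon-~ t)

  reps : List A
  reps = filter (λ r → canon r ≟ r) xs

  sumOver-classes : (c : ℕ) → (∀ r → count (λ t → ⌊ t ~? r ⌋) xs ≡ c) →
    (g : A → ℕ) → (∀ {t t'} → t ~ t' → g t ≡ g t') → sumOver xs g ≡ c * sumOver reps g
  sumOver-classes c size g g-inv = begin
    sumOver xs g
      ≡⟨ sumOver-cong xs (λ t → pick enum (canon t) (λ _ → g t)) ⟨
    sumOver xs (λ t → sumOver xs (λ r → if ⌊ r ≟ canon t ⌋ then g t else 0))
      ≡⟨ sumOver-swap xs xs _ ⟩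
    sumOver xs (λ r → sumOver xs (λ t → if ⌊ r ≟ canon t ⌋ then g t else 0))
      ≡⟨ sumOver-cong xs class-sum ⟩
    sumOver xs (λ r → if ⌊ canon r ≟ r ⌋ then c * g r else 0)
      ≡⟨ sumOver-filter (λ r → canon r ≟ r) xs (λ r → c * g r) ⟨
    sumOver reps (λ r → c * g r)
      ≡⟨ sumOver-scale reps c g ⟩
    c * sumOver reps g ∎
    where
      open ≡-Reasoning
      -- the elements with canonical representative r form the class of r if r is canonical, else none
      class-sum : ∀ r → sumOver xs (λ t → if ⌊ r ≟ canon t ⌋ then g t else 0) ≡ (if ⌊ canon r ≟ r ⌋ then c * g r else 0)
      class-sum r with canon r ≟ r
      ... | yes canonical = begin
        sumOver xs (λ t → if ⌊ r ≟ canon t ⌋ then g t else 0) ≡⟨ sumOver-cong xs in-class ⟩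
        sumOver xs (λ t → if ⌊ t ~? r ⌋ then g r else 0)      ≡⟨ sumOver-select xs (λ t → ⌊ t ~? r ⌋) (g r) ⟩
        count (λ t → ⌊ t ~? r ⌋) xs * g r                     ≡⟨ cong (_* g r) (size r) ⟩
        c * g r ∎
        where
          in-class : ∀ t → (if ⌊ r ≟ canon t ⌋ then g t else 0) ≡ (if ⌊ t ~? r ⌋ then g r else 0)
          in-class t with r ≟ canon t | t ~? r
          ... | yes _        | yes t~r  = g-inv t~r
          ... | yes r≡canont | no ¬t~r  = ⊥-elim (¬t~r (subst (t ~_) (sym r≡canont) (~-sym (canon-~ t))))
          ... | no r≢canont  | yes t~r  = ⊥-elim (r≢canont (trans (sym canonical) (canon-cong (~-sym t~r))))
          ... | no _         | no _     = refl
      ... | no ¬canonical = sumOver-zero xs (λ t → cong (λ b → if b then g t else 0)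
              (⌊⌋-false (r ≟ canon t) (λ r≡canont → ¬canonical (trans (cong canon r≡canont) (trans (canon-idem t) (sym r≡canont))))))

  classRep : Fin (length reps) → A
  classRep = lookup reps

  classRep-distinct : ∀ i j → classRep i ~ classRep j → i ≡ j
  classRep-distinct i j i~j = lookup-injective (Unique.filter⁺ (λ r → canon r ≟ r) (proj₁ enum)) i j (begin
    classRep i         ≡⟨ canonical i ⟨
    canon (classRep i) ≡⟨ canon-cong i~j ⟩
    canon (classRep j) ≡⟨ canonical j ⟩
    classRep j         ∎)
    where
      open ≡-Reasoning
      canonical : ∀ k → canon (classRep k) ≡ classRep k
      canonical k = proj₂ (∈-filter⁻ (λ r → canon r ≟ r) {xs = xs} (∈-lookup k))

  classRep-cover : ∀ t → Σ (Fin (length reps)) λ i → t ~ classRep i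
  classRep-cover t = Any.index canon∈reps , subst (t ~_) (lookup-index canon∈reps) (~-sym (canon-~ t))
    where
      canon∈reps : canon t ∈ reps
      canon∈reps = ∈-filter⁺ (λ r → canon r ≟ r) (proj₂ enum (canon t)) (canon-idem t)

-- Double counting of flags in an incidence structure with point list ys, block list js and incidence
-- I: the number of pairs (y , j) with y on block i and both z and y on block j is the sum, over the
-- blocks j through z, of the number of points that blocks i and j have in common.
flag-count : {P J : Set} (I : J → P → Bool) (ys : List P) (js : List J) (i : J) (z : P) →
  sumOver ys (λ y → if I i y then count (λ j → if I j z then I j y else false) js else 0)
    ≡ sumOver js (λ j → ind (I j z) * sumOver ys (λ y → ind (I i y) * ind (I j y)))
flag-count I ys js i z = begin
  sumOver ys (λ y → if I i y then count (λ j → if I j z then I j y else false) js else 0)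
    ≡⟨ sumOver-cong ys (λ y → sym (ind-* (I i y) _)) ⟩
  sumOver ys (λ y → ind (I i y) * count (λ j → if I j z then I j y else false) js)
    ≡⟨ sumOver-cong ys (λ y → cong (ind (I i y) *_) (trans (count≡sumOver _ js) (sumOver-cong js (λ j → ind-∧ (I j z) (I j y))))) ⟩
  sumOver ys (λ y → ind (I i y) * sumOver js (λ j → ind (I j z) * ind (I j y)))
    ≡⟨ sumOver-cong ys (λ y → sym (sumOver-scale js (ind (I i y)) _)) ⟩
  sumOver ys (λ y → sumOver js (λ j → ind (I i y) * (ind (I j z) * ind (I j y))))
    ≡⟨ sumOver-swap ys js _ ⟩
  sumOver js (λ j → sumOver ys (λ y → ind (I i y) * (ind (I j z) * ind (I j y))))
    ≡⟨ sumOver-cong js (λ j → sumOver-cong ys (λ y → swap-first (ind (I i y)) (ind (I j z)) (ind (I j y)))) ⟩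
  sumOver js (λ j → sumOver ys (λ y → ind (I j z) * (ind (I i y) * ind (I j y))))
    ≡⟨ sumOver-cong js (λ j → sumOver-scale ys (ind (I j z)) _) ⟩
  sumOver js (λ j → ind (I j z) * sumOver ys (λ y → ind (I i y) * ind (I j y))) ∎
  where
    open ≡-Reasoning
    swap-first : ∀ a b c → a * (b * c) ≡ b * (a * c)
    swap-first = solve-∀


module SubtractionLaws {X : Set} (_⊕_ _⊖_ : X → X → X)
  (⊕-comm  : ∀ a b → a ⊕ b ≡ b ⊕ a)
  (⊕-assoc : ∀ a b c → (a ⊕ b) ⊕ c ≡ a ⊕ (b ⊕ c))
  (⊖-⊕     : ∀ a b → (a ⊖ b) ⊕ b ≡ a)
  (⊕-⊖     : ∀ a b → (a ⊕ b) ⊖ b ≡ a) where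

  ⊕-cancelʳ : ∀ a c b → a ⊕ b ≡ c ⊕ b → a ≡ c
  ⊕-cancelʳ a c b e = trans (sym (⊕-⊖ a b)) (trans (cong (_⊖ b) e) (⊕-⊖ c b))

  ⊖-solve : ∀ a b c → a ≡ c ⊕ b → a ⊖ b ≡ c
  ⊖-solve _ b c refl = ⊕-⊖ c b

  ⊖-unsolve : ∀ a b c → a ⊖ b ≡ c → a ≡ c ⊕ b
  ⊖-unsolve a b _ refl = sym (⊖-⊕ a b)

  ⊕-⊖-inverse : ∀ x y → x ⊕ (y ⊖ x) ≡ y
  ⊕-⊖-inverse x y = trans (⊕-comm x (y ⊖ x)) (⊖-⊕ y x)

  ⊖-⊖-self : ∀ u a → u ⊖ (u ⊖ a) ≡ a
  ⊖-⊖-self u a = ⊖-solve u (u ⊖ a) a (sym (⊕-⊖-inverse a u))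

  ⊖-⊖ : ∀ x u a → x ⊖ (u ⊖ a) ≡ (x ⊖ u) ⊕ a
  ⊖-⊖ x u a = ⊖-solve x (u ⊖ a) ((x ⊖ u) ⊕ a) (sym (begin
    ((x ⊖ u) ⊕ a) ⊕ (u ⊖ a) ≡⟨ ⊕-assoc (x ⊖ u) a (u ⊖ a) ⟩
    (x ⊖ u) ⊕ (a ⊕ (u ⊖ a)) ≡⟨ cong ((x ⊖ u) ⊕_) (⊕-⊖-inverse a u) ⟩
    (x ⊖ u) ⊕ u             ≡⟨ ⊖-⊕ x u ⟩
    x                       ∎))
    where open ≡-Reasoning

  ⊖-⊕ʳ : ∀ x a u → x ⊖ (a ⊕ u) ≡ (x ⊖ u) ⊖ a
  ⊖-⊕ʳ x a u = ⊖-solve x (a ⊕ u) ((x ⊖ u) ⊖ a) (sym (begin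
    ((x ⊖ u) ⊖ a) ⊕ (a ⊕ u) ≡⟨ ⊕-assoc ((x ⊖ u) ⊖ a) a u ⟨
    (((x ⊖ u) ⊖ a) ⊕ a) ⊕ u ≡⟨ cong (_⊕ u) (⊖-⊕ (x ⊖ u) a) ⟩
    (x ⊖ u) ⊕ u             ≡⟨ ⊖-⊕ x u ⟩
    x                       ∎))
    where open ≡-Reasoning

  isolateʳ : ∀ y e v → y ≡ e ⊕ v → v ≡ y ⊖ e
  isolateʳ y e v h = sym (⊖-solve y e v (trans h (⊕-comm e v)))

  unisolateʳ : ∀ y e v → v ≡ y ⊖ e → y ≡ e ⊕ v
  unisolateʳ y e v h = trans (⊖-unsolve y e v (sym h)) (⊕-comm v e)

  private
    regroup : ∀ a b d → ((b ⊖ d) ⊕ a) ⊕ d ≡ a ⊕ b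
    regroup a b d = begin
      ((b ⊖ d) ⊕ a) ⊕ d ≡⟨ ⊕-assoc (b ⊖ d) a d ⟩
      (b ⊖ d) ⊕ (a ⊕ d) ≡⟨ cong ((b ⊖ d) ⊕_) (⊕-comm a d) ⟩
      (b ⊖ d) ⊕ (d ⊕ a) ≡⟨ ⊕-assoc (b ⊖ d) d a ⟨
      ((b ⊖ d) ⊕ d) ⊕ a ≡⟨ cong (_⊕ a) (⊖-⊕ b d) ⟩
      b ⊕ a             ≡⟨ ⊕-comm b a ⟩
      a ⊕ b             ∎
      where open ≡-Reasoning

  exchange : ∀ a b c d → a ⊕ b ≡ c ⊕ d → c ⊖ a ≡ b ⊖ d
  exchange a b c d e = ⊖-solve c a (b ⊖ d) (⊕-cancelʳ c ((b ⊖ d) ⊕ a) d (trans (sym e) (sym (regroup a b d))))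

  unexchange : ∀ a b c d → c ⊖ a ≡ b ⊖ d → a ⊕ b ≡ c ⊕ d
  unexchange a b c d e = trans (sym (regroup a b d)) (cong (_⊕ d) (sym (⊖-unsolve c a (b ⊖ d) e)))

module Residues (p : ℕ) .{{_ : NonZero p}} where

  infixl 6 _⊕_ _⊖_
  _⊕_ : Fp p → Fp p → Fp p
  _⊕_ = _+ₚ_ p

  _⊖_ : Fp p → Fp p → Fp p
  _⊖_ = _-ₚ_ p

  private
    toℕ-mod : ∀ k → toℕ (k mod p) ≡ k % p
    toℕ-mod k = FP.toℕ-fromℕ< (m%n<n k p)

    %-absorbˡ : ∀ k l → (k % p + l) % p ≡ (k + l) % p
    %-absorbˡ k l = begin
      (k % p + l) % p         ≡⟨ %-distribˡ-+ (k % p) l p ⟩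
      (k % p % p + l % p) % p ≡⟨ cong (λ z → (z + l % p) % p) (m%n%n≡m%n k p) ⟩
      (k % p + l % p) % p     ≡⟨ %-distribˡ-+ k l p ⟨
      (k + l) % p             ∎
      where open ≡-Reasoning

    %-absorbʳ : ∀ k l → (k + l % p) % p ≡ (k + l) % p
    %-absorbʳ k l = trans (cong (_% p) (+-comm k (l % p))) (trans (%-absorbˡ l k) (cong (_% p) (+-comm l k)))

    residue+p : ∀ (a : Fp p) k → k ≡ p → (toℕ a + k) % p ≡ toℕ a
    residue+p a k refl = trans ([m+n]%n≡m%n (toℕ a) p) (m<n⇒m%n≡m (FP.toℕ<n a))

  ⊕-comm : ∀ a b → a ⊕ b ≡ b ⊕ a
  ⊕-comm a b = cong (_mod p) (+-comm (toℕ a) (toℕ b))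

  ⊕-assoc : ∀ a b c → (a ⊕ b) ⊕ c ≡ a ⊕ (b ⊕ c)
  ⊕-assoc a b c = FP.toℕ-injective (begin
    toℕ ((a ⊕ b) ⊕ c)                 ≡⟨ toℕ-mod _ ⟩
    (toℕ (a ⊕ b) + toℕ c) % p         ≡⟨ cong (λ z → (z + toℕ c) % p) (toℕ-mod _) ⟩
    ((toℕ a + toℕ b) % p + toℕ c) % p ≡⟨ %-absorbˡ (toℕ a + toℕ b) (toℕ c) ⟩
    (toℕ a + toℕ b + toℕ c) % p       ≡⟨ cong (_% p) (+-assoc (toℕ a) (toℕ b) (toℕ c)) ⟩
    (toℕ a + (toℕ b + toℕ c)) % p     ≡⟨ %-absorbʳ (toℕ a) (toℕ b + toℕ c) ⟨
    (toℕ a + (toℕ b + toℕ c) % p) % p ≡⟨ cong (λ z → (toℕ a + z) % p) (toℕ-mod _) ⟨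
    (toℕ a + toℕ (b ⊕ c)) % p         ≡⟨ toℕ-mod _ ⟨
    toℕ (a ⊕ (b ⊕ c))                 ∎)
    where open ≡-Reasoning

  ⊖-⊕ : ∀ a b → (a ⊖ b) ⊕ b ≡ a
  ⊖-⊕ a b = FP.toℕ-injective (begin
    toℕ ((a ⊖ b) ⊕ b)                         ≡⟨ toℕ-mod _ ⟩
    (toℕ (a ⊖ b) + toℕ b) % p                 ≡⟨ cong (λ z → (z + toℕ b) % p) (toℕ-mod _) ⟩
    ((toℕ a + (p ∸ toℕ b)) % p + toℕ b) % p   ≡⟨ %-absorbˡ (toℕ a + (p ∸ toℕ b)) (toℕ b) ⟩
    (toℕ a + (p ∸ toℕ b) + toℕ b) % p         ≡⟨ cong (_% p) (+-assoc (toℕ a) (p ∸ toℕ b) (toℕ b)) ⟩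
    (toℕ a + (p ∸ toℕ b + toℕ b)) % p         ≡⟨ residue+p a _ (m∸n+n≡m (<⇒≤ (FP.toℕ<n b))) ⟩
    toℕ a                                     ∎)
    where open ≡-Reasoning

  ⊕-⊖ : ∀ a b → (a ⊕ b) ⊖ b ≡ a
  ⊕-⊖ a b = FP.toℕ-injective (begin
    toℕ ((a ⊕ b) ⊖ b)                         ≡⟨ toℕ-mod _ ⟩
    (toℕ (a ⊕ b) + (p ∸ toℕ b)) % p           ≡⟨ cong (λ z → (z + (p ∸ toℕ b)) % p) (toℕ-mod _) ⟩
    ((toℕ a + toℕ b) % p + (p ∸ toℕ b)) % p   ≡⟨ %-absorbˡ (toℕ a + toℕ b) (p ∸ toℕ b) ⟩
    (toℕ a + toℕ b + (p ∸ toℕ b)) % p         ≡⟨ cong (_% p) (+-assoc (toℕ a) (toℕ b) (p ∸ toℕ b)) ⟩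
    (toℕ a + (toℕ b + (p ∸ toℕ b))) % p       ≡⟨ residue+p a _ (m+[n∸m]≡n (<⇒≤ (FP.toℕ<n b))) ⟩
    toℕ a                                     ∎)
    where open ≡-Reasoning

  open SubtractionLaws _⊕_ _⊖_ ⊕-comm ⊕-assoc ⊖-⊕ ⊕-⊖ public

module Space (p : ℕ) .{{_ : NonZero p}} where

  open Residues p
  open Enumeration

  infixl 6 _⊕ᵥ_ _⊖ᵥ_
  _⊕ᵥ_ : ∀ {n} → V p n → V p n → V p n
  _⊕ᵥ_ = _+ᵥ_ p

  _⊖ᵥ_ : ∀ {n} → V p n → V p n → V p n
  _⊖ᵥ_ = _-ᵥ_ p

  ⊖ᵥ-⊕ᵥ : ∀ {n} (x y : V p n) → (x ⊖ᵥ y) ⊕ᵥ y ≡ x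
  ⊖ᵥ-⊕ᵥ []      []      = refl
  ⊖ᵥ-⊕ᵥ (a ∷ x) (b ∷ y) = cong₂ _∷_ (⊖-⊕ a b) (⊖ᵥ-⊕ᵥ x y)

  ⊕ᵥ-⊖ᵥ : ∀ {n} (x y : V p n) → (x ⊕ᵥ y) ⊖ᵥ y ≡ x
  ⊕ᵥ-⊖ᵥ []      []      = refl
  ⊕ᵥ-⊖ᵥ (a ∷ x) (b ∷ y) = cong₂ _∷_ (⊕-⊖ a b) (⊕ᵥ-⊖ᵥ x y)

  module Vec-laws {n : ℕ} = SubtractionLaws (_⊕ᵥ_ {n}) _⊖ᵥ_
    (VecP.zipWith-comm ⊕-comm) (VecP.zipWith-assoc ⊕-assoc) ⊖ᵥ-⊕ᵥ ⊕ᵥ-⊖ᵥ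

  _≟ᵥ_ : ∀ {n} → DecidableEquality (V p n)
  _≟ᵥ_ = VecP.≡-dec F._≟_

  _≟ₚ_ : ∀ {n} → DecidableEquality (Point p n)
  _≟ₚ_ = ×P.≡-dec _≟ᵥ_ F._≟_

  allFp-enum : IsEnumeration F._≟_ (allFin p)
  allFp-enum = Unique.allFin⁺ p , ∈-allFin

  allV-enum : ∀ n → IsEnumeration _≟ᵥ_ (allV p n)
  allV-enum zero    = ([] ∷ []) , λ { [] → here refl }
  allV-enum (suc n) = subst (IsEnumeration _≟ᵥ_) (sym (concatMap≡cartesianProductWith _∷_ (allFin p) (allV p n)))
    ( Unique.cartesianProductWith⁺ _∷_ VecP.∷-injective (proj₁ allFp-enum) (proj₁ (allV-enum n))
    , λ { (a ∷ x) → ∈-cartesianProductWith⁺ _∷_ (∈-allFin a) (proj₂ (allV-enum n) x) })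

  allPoints-enum : ∀ n → IsEnumeration _≟ₚ_ (allPoints p n)
  allPoints-enum n = subst (IsEnumeration _≟ₚ_) (sym (concatMap≡cartesianProductWith _,_ (allV p n) (allFin p)))
    ( Unique.cartesianProduct⁺ (proj₁ (allV-enum n)) (proj₁ allFp-enum)
    , λ { (x , c) → ∈-cartesianProductWith⁺ _,_ (proj₂ (allV-enum n) x) (∈-allFin c) })

  length-allV : ∀ n → length (allV p n) ≡ p ^ n
  length-allV zero    = refl
  length-allV (suc n) = begin
    length (allV p (suc n))                                      ≡⟨ cong length (concatMap≡cartesianProductWith _∷_ (allFin p) (allV p n)) ⟩
    length (cartesianProductWith _∷_ (allFin p) (allV p n))      ≡⟨ length-product _∷_ (allFin p) (allV p n) ⟩
    length (allFin p) * length (allV p n)                        ≡⟨ cong₂ _*_ (LP.length-tabulate {n = p} (λ i → i)) (length-allV n) ⟩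
    p * p ^ n                                                    ∎
    where open ≡-Reasoning

  length-allPoints : ∀ n → length (allPoints p n) ≡ p ^ n * p
  length-allPoints n = begin
    length (allPoints p n)                                       ≡⟨ cong length (concatMap≡cartesianProductWith _,_ (allV p n) (allFin p)) ⟩
    length (cartesianProductWith _,_ (allV p n) (allFin p))      ≡⟨ length-product _,_ (allV p n) (allFin p) ⟩
    length (allV p n) * length (allFin p)                        ≡⟨ cong₂ _*_ (length-allV n) (LP.length-tabulate {n = p} (λ i → i)) ⟩
    p ^ n * p                                                    ∎
    where open ≡-Reasoning

  sumOver-allPoints : ∀ n (g : Point p n → ℕ) → sumOver (allPoints p n) g ≡ sumOver (allV p n) (λ x → sumOver (allFin p) (λ c → g (x , c)))
  sumOver-allPoints n g = trans (cong (λ zs → sumOver zs g) (concatMap≡cartesianProductWith _,_ (allV p n) (allFin p)))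
    (sumOver-product _,_ (allV p n) (allFin p) g)


-- The design of translates of the graph of a partially bent function f : F_p^n → F_p, for p ≥ 2
-- and n ≥ 1 (written p = 2 + q, n = 1 + m).
module Design (q m : ℕ) (f : V (suc (suc q)) (suc m) → Fp (suc (suc q)))
  (pb : PartiallyBent (suc (suc q)) (suc m) f) (s : ℕ) (ld : LinearSpaceDim (suc (suc q)) (suc m) f s) where

  p n : ℕ
  p = suc (suc q)
  n = suc m

  open Residues p
  open Space p
  open Enumeration

  -- Points (x , y) of F_p^n × F_p; a point t = (u , v) also names the translate (u , v) + G_f.
  Pt : Set
  Pt = Point p n

  -- A constant function V p n → F_p takes its value p^n ≠ p^(n-1) times, so it is not balanced.
  balanced⇒¬constant : {g : V p n → Fp p} → Balanced p n g → ¬ Constant p g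
  balanced⇒¬constant {g} bal (c , g≡c) = <⇒≢ p^m<p^n (trans (sym (bal c)) all-c)
    where
      all-c : count (λ x → ⌊ g x F.≟ c ⌋) (allV p n) ≡ p ^ n
      all-c = trans (count≡sumOver _ (allV p n))
        (trans (sumOver-cong (allV p n) (λ x → cong ind (⌊⌋-true (g x F.≟ c) (g≡c x))))
          (trans (sym (length≡sumOver (allV p n))) (length-allV n)))
      p^m<p^n : p ^ m < p ^ n
      p^m<p^n = ^-monoʳ-< p (s≤s (s≤s z≤n)) (n<1+n m)

  linear? : (a : V p n) → Dec (InLinearSpace p f a)
  linear? a with pb a
  ... | inj₁ bal = no (balanced⇒¬constant bal)
  ... | inj₂ con = yes con

  nonlinear⇒balanced : ∀ a → ¬ InLinearSpace p f a → Balanced p n (D p f a)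
  nonlinear⇒balanced a ¬lin with pb a
  ... | inj₁ bal = bal
  ... | inj₂ con = ⊥-elim (¬lin con)

  lincomb-cong : ∀ {k} (c c' : Fin k → Fp p) (b : Fin k → V p n) → (∀ i → c i ≡ c' i) → lincomb p k c b ≡ lincomb p k c' b
  lincomb-cong {zero}  c c' b e = refl
  lincomb-cong {suc k} c c' b e = cong₂ (_+ᵥ_ p) (cong (λ z → _•_ p z (b F.zero)) (e F.zero))
    (lincomb-cong (λ i → c (F.suc i)) (λ i → c' (F.suc i)) (λ i → b (F.suc i)) (λ i → e (F.suc i)))

  -- The linear space has p^s elements: c ↦ Σ cᵢ bᵢ is a bijection from F_p^s onto it.
  linearSpace-size : count (λ a → ⌊ linear? a ⌋) (allV p n) ≡ p ^ s
  linearSpace-size = trans (count-image _≟ᵥ_ _≟ᵥ_ (allV-enum s) (allV-enum n) linear? span span-injective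
      (λ c → in-span (Vec.lookup c)) onto) (length-allV s)
    where
      basis = proj₁ ld
      in-span = proj₁ (proj₂ ld)
      spanned = proj₁ (proj₂ (proj₂ ld))
      independent = proj₂ (proj₂ (proj₂ ld))

      span : V p s → V p n
      span c = lincomb p s (Vec.lookup c) basis

      span-injective : ∀ c c' → span c ≡ span c' → c ≡ c'
      span-injective c c' e = begin
        c                         ≡⟨ VecP.tabulate∘lookup c ⟨
        Vec.tabulate (Vec.lookup c)  ≡⟨ VecP.tabulate-cong (independent (Vec.lookup c) (Vec.lookup c') e) ⟩
        Vec.tabulate (Vec.lookup c') ≡⟨ VecP.tabulate∘lookup c' ⟩
        c'                        ∎
        where open ≡-Reasoning

      onto : ∀ a → InLinearSpace p f a → Σ (V p s) λ c → span c ≡ a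
      onto a lin = let (c , e) = spanned a lin in
        Vec.tabulate c , trans (lincomb-cong _ c basis (VecP.lookup∘tabulate c)) e

  ^-split : ∀ {e} → s ≤ e → p ^ s * p ^ (e ∸ s) ≡ p ^ e
  ^-split {e} s≤e = trans (sym (^-distribˡ-+-* p s (e ∸ s))) (cong (p ^_) (m+[n∸m]≡n s≤e))

  ^-suc : p ^ n * p ≡ p ^ (n + 1)
  ^-suc = trans (*-comm (p ^ n) p) (cong (p ^_) (+-comm 1 n))

  s≤n : s ≤ n
  s≤n = ≮⇒≥ (λ n<s → <⇒≱ (^-monoʳ-< p (s≤s (s≤s z≤n)) n<s) (begin
    p ^ s                                    ≡⟨ linearSpace-size ⟨
    count (λ a → ⌊ linear? a ⌋) (allV p n)   ≤⟨ count≤length _ (allV p n) ⟩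
    length (allV p n)                        ≡⟨ length-allV n ⟩
    p ^ n                                    ∎))
    where open ≤-Reasoning

  value : Pt → V p n → Fp p
  value (u , v) x = f (x ⊖ᵥ u) ⊕ v

  on : Pt → Pt → Bool
  on t z = inTranslate p f t z

  sameBlock⇒sameValues : ∀ {t t'} → SameBlock p f t t' → ∀ x → value t x ≡ value t' x
  sameBlock⇒sameValues {t} {t'} same x = ⌊⌋-sound (value t x F.≟ value t' x)
    (trans (sym (same (x , value t x))) (⌊⌋-true (value t x F.≟ value t x) refl))

  sameValues⇒sameBlock : ∀ {t t'} → (∀ x → value t x ≡ value t' x) → SameBlock p f t t'
  sameValues⇒sameBlock same (x , y) = cong (λ w → ⌊ y F.≟ w ⌋) (same x)

  sameBlock? : Decidable (SameBlock p f)
  sameBlock? t t' = decide-∀ _≟ₚ_ (allPoints-enum n) (λ z → on t z Bool.≟ on t' z)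

  -- Translating by (a , c) fixes a block iff f (x ⊕ a) ⊖ f x ≡ c for all x.
  _⊕ₚ_ _⊖ₚ_ : Pt → Pt → Pt
  (a , c) ⊕ₚ (u , v) = (a ⊕ᵥ u , c ⊕ v)
  (a , c) ⊖ₚ (u , v) = (a ⊖ᵥ u , c ⊖ v)

  Shift : Pt → Set
  Shift (a , c) = ∀ x → D p f a x ≡ c

  shift? : U.Decidable Shift
  shift? (a , c) = decide-∀ _≟ᵥ_ (allV-enum n) (λ x → D p f a x F.≟ c)

  shift⇒sameBlock : ∀ t r → Shift t → SameBlock p f (t ⊕ₚ r) r
  shift⇒sameBlock (a , c) (u , v) shift = sameValues⇒sameBlock (λ x → begin
    f (x ⊖ᵥ (a ⊕ᵥ u)) ⊕ (c ⊕ v)          ≡⟨ cong (λ w → f w ⊕ (c ⊕ v)) (Vec-laws.⊖-⊕ʳ x a u) ⟩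
    f ((x ⊖ᵥ u) ⊖ᵥ a) ⊕ (c ⊕ v)          ≡⟨ ⊕-assoc (f ((x ⊖ᵥ u) ⊖ᵥ a)) c v ⟨
    (f ((x ⊖ᵥ u) ⊖ᵥ a) ⊕ c) ⊕ v          ≡⟨ cong (_⊕ v) (trans (⊕-comm (f ((x ⊖ᵥ u) ⊖ᵥ a)) c) (sym (⊖-unsolve (f (((x ⊖ᵥ u) ⊖ᵥ a) ⊕ᵥ a)) (f ((x ⊖ᵥ u) ⊖ᵥ a)) c (shift ((x ⊖ᵥ u) ⊖ᵥ a))))) ⟩
    f (((x ⊖ᵥ u) ⊖ᵥ a) ⊕ᵥ a) ⊕ v         ≡⟨ cong (λ w → f w ⊕ v) (⊖ᵥ-⊕ᵥ (x ⊖ᵥ u) a) ⟩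
    f (x ⊖ᵥ u) ⊕ v                       ∎)
    where open ≡-Reasoning

  sameBlock⇒shift : ∀ t r → SameBlock p f (t ⊕ₚ r) r → Shift t
  sameBlock⇒shift (a , c) (u , v) same x = ⊖-solve (f (x ⊕ᵥ a)) (f x) c (⊕-cancelʳ (f (x ⊕ᵥ a)) (c ⊕ f x) v (begin
    f (x ⊕ᵥ a) ⊕ v                              ≡⟨ cong (λ w → f w ⊕ v) (⊕ᵥ-⊖ᵥ (x ⊕ᵥ a) u) ⟨
    f (((x ⊕ᵥ a) ⊕ᵥ u) ⊖ᵥ u) ⊕ v                ≡⟨ sameBlock⇒sameValues same ((x ⊕ᵥ a) ⊕ᵥ u) ⟨
    f (((x ⊕ᵥ a) ⊕ᵥ u) ⊖ᵥ (a ⊕ᵥ u)) ⊕ (c ⊕ v)   ≡⟨ cong (λ w → f w ⊕ (c ⊕ v)) (Vec-laws.⊖-⊕ʳ ((x ⊕ᵥ a) ⊕ᵥ u) a u) ⟩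
    f ((((x ⊕ᵥ a) ⊕ᵥ u) ⊖ᵥ u) ⊖ᵥ a) ⊕ (c ⊕ v)   ≡⟨ cong (λ w → f (w ⊖ᵥ a) ⊕ (c ⊕ v)) (⊕ᵥ-⊖ᵥ (x ⊕ᵥ a) u) ⟩
    f ((x ⊕ᵥ a) ⊖ᵥ a) ⊕ (c ⊕ v)                 ≡⟨ cong (λ w → f w ⊕ (c ⊕ v)) (⊕ᵥ-⊖ᵥ x a) ⟩
    f x ⊕ (c ⊕ v)                               ≡⟨ ⊕-assoc (f x) c v ⟨
    (f x ⊕ c) ⊕ v                               ≡⟨ cong (_⊕ v) (⊕-comm (f x) c) ⟩
    (c ⊕ f x) ⊕ v                               ∎))
    where open ≡-Reasoning

  shift-count : ∀ a → sumOver (allFin p) (λ c → ind ⌊ shift? (a , c) ⌋) ≡ ind ⌊ linear? a ⌋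
  shift-count a with linear? a
  ... | yes (c₀ , D≡c₀) = trans (sumOver-cong (allFin p) (λ c → cong ind
          (does-cong (λ shift → trans (sym (shift origin)) (D≡c₀ origin))
                     (λ c≡c₀ x → trans (D≡c₀ x) (sym c≡c₀)) (shift? (a , c)) (c F.≟ c₀))))
          (pick F._≟_ allFp-enum c₀ (λ _ → 1))
    where origin = zeroᵥ p n
  ... | no ¬linear = sumOver-zero (allFin p) (λ c → cong ind (⌊⌋-false (shift? (a , c)) (λ shift → ¬linear (c , shift))))

  class-size : ∀ r → count (λ t → ⌊ sameBlock? t r ⌋) (allPoints p n) ≡ p ^ s
  class-size r = begin
    count (λ t → ⌊ sameBlock? t r ⌋) (allPoints p n)
      ≡⟨ count≡sumOver _ (allPoints p n) ⟩
    sumOver (allPoints p n) (λ t → ind ⌊ sameBlock? t r ⌋)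
      ≡⟨ sumOver-bijection _≟ₚ_ (allPoints-enum n) (_⊕ₚ r) (_⊖ₚ r) ⊖ₚ-⊕ₚ ⊕ₚ-⊖ₚ _ ⟨
    sumOver (allPoints p n) (λ t → ind ⌊ sameBlock? (t ⊕ₚ r) r ⌋)
      ≡⟨ sumOver-cong (allPoints p n) (λ t → cong ind (does-cong (sameBlock⇒shift t r) (shift⇒sameBlock t r) _ (shift? t))) ⟩
    sumOver (allPoints p n) (λ t → ind ⌊ shift? t ⌋)
      ≡⟨ sumOver-allPoints n _ ⟩
    sumOver (allV p n) (λ a → sumOver (allFin p) (λ c → ind ⌊ shift? (a , c) ⌋))
      ≡⟨ sumOver-cong (allV p n) shift-count ⟩
    sumOver (allV p n) (λ a → ind ⌊ linear? a ⌋)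
      ≡⟨ count≡sumOver _ (allV p n) ⟨
    count (λ a → ⌊ linear? a ⌋) (allV p n)
      ≡⟨ linearSpace-size ⟩
    p ^ s ∎
    where
      open ≡-Reasoning
      ⊖ₚ-⊕ₚ : ∀ t → (t ⊕ₚ r) ⊖ₚ r ≡ t
      ⊖ₚ-⊕ₚ (a , c) = cong₂ _,_ (⊕ᵥ-⊖ᵥ a (proj₁ r)) (⊕-⊖ c (proj₂ r))
      ⊕ₚ-⊖ₚ : ∀ t → (t ⊖ₚ r) ⊕ₚ r ≡ t
      ⊕ₚ-⊖ₚ (a , c) = cong₂ _,_ (⊖ᵥ-⊕ᵥ a (proj₁ r)) (⊖-⊕ c (proj₂ r))

  open Classes _≟ₚ_ (allPoints-enum n) sameBlock? (λ z → refl) (λ same z → sym (same z))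
    (λ same same' z → trans (same z) (same' z))

  sumOver-translates : (g : Pt → ℕ) → (∀ {t t'} → SameBlock p f t t' → g t ≡ g t') →
    sumOver (allPoints p n) g ≡ p ^ s * sumOver reps g
  sumOver-translates = sumOver-classes (p ^ s) class-size

  block-count : length reps ≡ p ^ (n + 1 ∸ s)
  block-count = *-cancelˡ-≡ (length reps) (p ^ (n + 1 ∸ s)) (p ^ s) {{m^n≢0 p s}} (begin
    p ^ s * length reps                     ≡⟨ cong (p ^ s *_) (length≡sumOver reps) ⟩
    p ^ s * sumOver reps (λ _ → 1)          ≡⟨ sumOver-translates (λ _ → 1) (λ _ → refl) ⟨
    sumOver (allPoints p n) (λ _ → 1)       ≡⟨ length≡sumOver (allPoints p n) ⟨
    length (allPoints p n)                  ≡⟨ length-allPoints n ⟩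
    p ^ n * p                               ≡⟨ ^-suc ⟩
    p ^ (n + 1)                             ≡⟨ ^-split (m≤n⇒m≤n+o 1 s≤n) ⟨
    p ^ s * p ^ (n + 1 ∸ s)                 ∎)
    where open ≡-Reasoning

  sumOver-on : ∀ t (h : Pt → ℕ) → sumOver (allPoints p n) (λ z → ind (on t z) * h z) ≡ sumOver (allV p n) (λ x → h (x , value t x))
  sumOver-on t h = trans (sumOver-allPoints n _) (sumOver-cong (allV p n) (λ x →
    trans (sumOver-cong (allFin p) (λ y → ind-* (on t (x , y)) (h (x , y))))
          (pick F._≟_ allFp-enum (value t x) (λ y → h (x , y)))))

  sumOver-through : ∀ x y (h : Pt → ℕ) →
    sumOver (allPoints p n) (λ t → ind (on t (x , y)) * h t) ≡ sumOver (allV p n) (λ u → h (u , y ⊖ f (x ⊖ᵥ u)))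
  sumOver-through x y h = trans (sumOver-allPoints n _) (sumOver-cong (allV p n) (λ u →
    trans (sumOver-cong (allFin p) (λ v → trans (ind-* (on (u , v) (x , y)) (h (u , v)))
            (cong (λ b → if b then h (u , v) else 0)
              (does-cong (isolateʳ y (f (x ⊖ᵥ u)) v) (unisolateʳ y (f (x ⊖ᵥ u)) v) (y F.≟ value (u , v) x) (v F.≟ y ⊖ f (x ⊖ᵥ u))))))
          (pick F._≟_ allFp-enum (y ⊖ f (x ⊖ᵥ u)) (λ v → h (u , v)))))

  block : Fin (length reps) → Pt
  block = classRep

  -- Every block has p^n points, one over each abscissa.
  block-size : ∀ i → count (on (block i)) (allPoints p n) ≡ p ^ n
  block-size i = begin
    count (on (block i)) (allPoints p n)                       ≡⟨ count≡sumOver _ (allPoints p n) ⟩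
    sumOver (allPoints p n) (λ z → ind (on (block i) z))       ≡⟨ sumOver-cong (allPoints p n) (λ z → *-identityʳ _) ⟨
    sumOver (allPoints p n) (λ z → ind (on (block i) z) * 1)   ≡⟨ sumOver-on (block i) (λ _ → 1) ⟩
    sumOver (allV p n) (λ _ → 1)                               ≡⟨ length≡sumOver (allV p n) ⟨
    length (allV p n)                                          ≡⟨ length-allV n ⟩
    p ^ n                                                      ∎
    where open ≡-Reasoning

  -- A point lies on p^n translates, hence on p^(n-s) blocks.
  replication : ∀ z → count (λ i → on (block i) z) (allFin (length reps)) ≡ p ^ (n ∸ s)
  replication (x , y) = *-cancelˡ-≡ _ _ (p ^ s) {{m^n≢0 p s}} (begin
    p ^ s * count (λ i → on (block i) (x , y)) (allFin (length reps))
      ≡⟨ cong (p ^ s *_) (trans (count≡sumOver _ (allFin (length reps))) (sumOver-lookup reps (λ r → ind (on r (x , y))))) ⟩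
    p ^ s * sumOver reps (λ r → ind (on r (x , y)))
      ≡⟨ sumOver-translates (λ r → ind (on r (x , y))) (λ same → cong ind (same (x , y))) ⟨
    sumOver (allPoints p n) (λ t → ind (on t (x , y)))
      ≡⟨ sumOver-cong (allPoints p n) (λ t → *-identityʳ _) ⟨
    sumOver (allPoints p n) (λ t → ind (on t (x , y)) * 1)
      ≡⟨ sumOver-through x y (λ _ → 1) ⟩
    sumOver (allV p n) (λ _ → 1)
      ≡⟨ length≡sumOver (allV p n) ⟨
    length (allV p n)
      ≡⟨ length-allV n ⟩
    p ^ n
      ≡⟨ ^-split s≤n ⟨
    p ^ s * p ^ (n ∸ s) ∎)
    where open ≡-Reasoning

  meet : Pt → Pt → ℕ
  meet t t' = sumOver (allPoints p n) (λ z → ind (on t z) * ind (on t' z))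

  meet-values : ∀ t t' → meet t t' ≡ sumOver (allV p n) (λ x → ind ⌊ value t x F.≟ value t' x ⌋)
  meet-values t t' = sumOver-on t (λ z → ind (on t' z))

  -- The count defining α and β: pairs (y , j) with y on block i and both z and y on block j.
  pairs : Fin (length reps) → Pt → ℕ
  pairs i z = sumOver (allPoints p n) λ y →
    if on (block i) y then count (λ j → if on (block j) z then on (block j) y else false) (allFin (length reps)) else 0

  pairs-translates : ∀ i z → p ^ s * pairs i z ≡ sumOver (allPoints p n) (λ t → ind (on t z) * meet (block i) t)
  pairs-translates i z = begin
    p ^ s * pairs i z
      ≡⟨ cong (p ^ s *_) (flag-count (λ j → on (block j)) (allPoints p n) (allFin (length reps)) i z) ⟩
    p ^ s * sumOver (allFin (length reps)) (λ j → ind (on (block j) z) * meet (block i) (block j))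
      ≡⟨ cong (p ^ s *_) (sumOver-lookup reps (λ r → ind (on r z) * meet (block i) r)) ⟩
    p ^ s * sumOver reps (λ r → ind (on r z) * meet (block i) r)
      ≡⟨ sumOver-translates (λ r → ind (on r z) * meet (block i) r) meet-through-invariant ⟨
    sumOver (allPoints p n) (λ t → ind (on t z) * meet (block i) t) ∎
    where
      open ≡-Reasoning
      meet-through-invariant : ∀ {t t'} → SameBlock p f t t' → ind (on t z) * meet (block i) t ≡ ind (on t' z) * meet (block i) t'
      meet-through-invariant same = cong₂ _*_ (cong ind (same z))
        (sumOver-cong (allPoints p n) (λ y → cong (λ b → ind (on (block i) y) * ind b) (same y)))

  -- Agreements of f with its translate by a, shifted so as to count the common points of
  -- t₀ = (u₀ , v₀) and the translate through z = (x , y) with u = u₀ ⊖ a.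
  agreements : Pt → Pt → V p n → ℕ
  agreements (u₀ , v₀) (x , y) a = sumOver (allV p n) (λ w → ind ⌊ f w ⊕ v₀ F.≟ f (w ⊕ᵥ a) ⊕ (y ⊖ f ((x ⊖ᵥ u₀) ⊕ᵥ a)) ⌋)

  meets-through : ∀ t₀ z → sumOver (allPoints p n) (λ t → ind (on t z) * meet t₀ t) ≡ sumOver (allV p n) (agreements t₀ z)
  meets-through (u₀ , v₀) (x , y) = begin
    sumOver (allPoints p n) (λ t → ind (on t (x , y)) * meet (u₀ , v₀) t)
      ≡⟨ sumOver-through x y (meet (u₀ , v₀)) ⟩
    sumOver (allV p n) (λ u → meet (u₀ , v₀) (u , y ⊖ f (x ⊖ᵥ u)))
      ≡⟨ sumOver-cong (allV p n) (λ u → meet-values (u₀ , v₀) _) ⟩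
    sumOver (allV p n) (λ u → sumOver (allV p n) (agree u))
      ≡⟨ sumOver-bijection _≟ᵥ_ (allV-enum n) (u₀ ⊖ᵥ_) (u₀ ⊖ᵥ_) (Vec-laws.⊖-⊖-self u₀) (Vec-laws.⊖-⊖-self u₀) _ ⟨
    sumOver (allV p n) (λ a → sumOver (allV p n) (agree (u₀ ⊖ᵥ a)))
      ≡⟨ sumOver-cong (allV p n) (λ a → sumOver-bijection _≟ᵥ_ (allV-enum n) (_⊕ᵥ u₀) (_⊖ᵥ u₀)
           (λ w → ⊕ᵥ-⊖ᵥ w u₀) (λ w → ⊖ᵥ-⊕ᵥ w u₀) (agree (u₀ ⊖ᵥ a))) ⟨
    sumOver (allV p n) (λ a → sumOver (allV p n) (λ w → agree (u₀ ⊖ᵥ a) (w ⊕ᵥ u₀)))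
      ≡⟨ sumOver-cong (allV p n) (λ a → sumOver-cong (allV p n) (λ w → cong₂ (λ l r → ind ⌊ l F.≟ r ⌋)
           (cong (λ w' → f w' ⊕ v₀) (⊕ᵥ-⊖ᵥ w u₀))
           (cong₂ (λ w' x' → f w' ⊕ (y ⊖ f x'))
             (trans (Vec-laws.⊖-⊖ (w ⊕ᵥ u₀) u₀ a) (cong (_⊕ᵥ a) (⊕ᵥ-⊖ᵥ w u₀)))
             (Vec-laws.⊖-⊖ x u₀ a)))) ⟩
    sumOver (allV p n) (agreements (u₀ , v₀) (x , y)) ∎
    where
      open ≡-Reasoning
      agree : V p n → V p n → ℕ
      agree u x' = ind ⌊ value (u₀ , v₀) x' F.≟ value (u , y ⊖ f (x ⊖ᵥ u)) x' ⌋

  -- For a in the linear space the agreement is total or empty according to whether z lies on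
  -- t₀; otherwise the derivative D_a f is balanced and the agreements number p^(n-1).
  agreements-value : ∀ t₀ z a → agreements t₀ z a ≡ (if ⌊ linear? a ⌋ then p ^ n * ind (on t₀ z) else p ^ m)
  agreements-value (u₀ , v₀) (x , y) a = trans (sumOver-cong (allV p n) (λ w → cong ind (as-derivative w))) (by-case (linear? a))
    where
      x₀ = x ⊖ᵥ u₀
      K  = y ⊖ f (x₀ ⊕ᵥ a)

      -- f w ⊕ v₀ ≡ f (w ⊕ a) ⊕ K says that D_a f takes the value v₀ ⊖ K at w.
      as-derivative : ∀ w → ⌊ f w ⊕ v₀ F.≟ f (w ⊕ᵥ a) ⊕ K ⌋ ≡ ⌊ D p f a w F.≟ v₀ ⊖ K ⌋
      as-derivative w = does-cong (exchange (f w) v₀ (f (w ⊕ᵥ a)) K) (unexchange (f w) v₀ (f (w ⊕ᵥ a)) K) _ _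

      at-x₀ : ⌊ f x₀ ⊕ v₀ F.≟ f (x₀ ⊕ᵥ a) ⊕ K ⌋ ≡ on (u₀ , v₀) (x , y)
      at-x₀ = does-cong (λ e → sym (trans e (⊕-⊖-inverse (f (x₀ ⊕ᵥ a)) y)))
                        (λ e → trans (sym e) (sym (⊕-⊖-inverse (f (x₀ ⊕ᵥ a)) y))) _ _

      by-case : (d : Dec (InLinearSpace p f a)) →
        sumOver (allV p n) (λ w → ind ⌊ D p f a w F.≟ v₀ ⊖ K ⌋) ≡ (if ⌊ d ⌋ then p ^ n * ind (on (u₀ , v₀) (x , y)) else p ^ m)
      by-case (yes (c , D≡c)) = begin
        sumOver (allV p n) (λ w → ind ⌊ D p f a w F.≟ v₀ ⊖ K ⌋)
          ≡⟨ sumOver-cong (allV p n) (λ w → cong (λ e → ind ⌊ e F.≟ v₀ ⊖ K ⌋) (trans (D≡c w) (sym (D≡c x₀)))) ⟩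
        sumOver (allV p n) (λ _ → ind ⌊ D p f a x₀ F.≟ v₀ ⊖ K ⌋)
          ≡⟨ sumOver-const (allV p n) _ ⟩
        length (allV p n) * ind ⌊ D p f a x₀ F.≟ v₀ ⊖ K ⌋
          ≡⟨ cong₂ (λ l b → l * ind b) (length-allV n) (trans (sym (as-derivative x₀)) at-x₀) ⟩
        p ^ n * ind (on (u₀ , v₀) (x , y)) ∎
        where open ≡-Reasoning
      by-case (no ¬linear) = trans (sym (count≡sumOver _ (allV p n))) (nonlinear⇒balanced a ¬linear (v₀ ⊖ K))

  pairs-value : ∀ i z → p ^ s * pairs i z ≡ p ^ s * (p ^ n * ind (on (block i) z)) + (p ^ n ∸ p ^ s) * p ^ m
  pairs-value i z = begin
    p ^ s * pairs i z
      ≡⟨ pairs-translates i z ⟩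
    sumOver (allPoints p n) (λ t → ind (on t z) * meet (block i) t)
      ≡⟨ meets-through (block i) z ⟩
    sumOver (allV p n) (agreements (block i) z)
      ≡⟨ sumOver-cong (allV p n) (agreements-value (block i) z) ⟩
    sumOver (allV p n) (λ a → if ⌊ linear? a ⌋ then p ^ n * ind (on (block i) z) else p ^ m)
      ≡⟨ sumOver-if (allV p n) (λ a → ⌊ linear? a ⌋) _ _ ⟩
    count (λ a → ⌊ linear? a ⌋) (allV p n) * (p ^ n * ind (on (block i) z))
      + (length (allV p n) ∸ count (λ a → ⌊ linear? a ⌋) (allV p n)) * p ^ m
      ≡⟨ cong₂ (λ k l → k * (p ^ n * ind (on (block i) z)) + (l ∸ k) * p ^ m) linearSpace-size (length-allV n) ⟩
    p ^ s * (p ^ n * ind (on (block i) z)) + (p ^ n ∸ p ^ s) * p ^ m ∎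
    where open ≡-Reasoning

  α β : ℕ
  α = p ^ (2 * n ∸ 1 ∸ s) ∸ p ^ (n ∸ 1)
  β = p ^ n + p ^ (2 * n ∸ 1 ∸ s) ∸ p ^ (n ∸ 1)

  private
    2n∸1≡n+m : 2 * n ∸ 1 ≡ n + m
    2n∸1≡n+m = trans (cong (m +_) (+-identityʳ n)) (+-comm m n)

    s≤2n∸1 : s ≤ 2 * n ∸ 1
    s≤2n∸1 = subst (s ≤_) (sym 2n∸1≡n+m) (m≤n⇒m≤n+o m s≤n)

    p^m≤p^[2n∸1∸s] : p ^ m ≤ p ^ (2 * n ∸ 1 ∸ s)
    p^m≤p^[2n∸1∸s] = ^-monoʳ-≤ p (subst (m ≤_) (sym (trans (cong (_∸ s) 2n∸1≡n+m) (+-∸-comm m s≤n))) (m≤n+m m (n ∸ s)))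

  α-scaled : p ^ s * α ≡ (p ^ n ∸ p ^ s) * p ^ m
  α-scaled = begin
    p ^ s * (p ^ (2 * n ∸ 1 ∸ s) ∸ p ^ m)          ≡⟨ *-distribˡ-∸ (p ^ s) (p ^ (2 * n ∸ 1 ∸ s)) (p ^ m) ⟩
    p ^ s * p ^ (2 * n ∸ 1 ∸ s) ∸ p ^ s * p ^ m    ≡⟨ cong (_∸ p ^ s * p ^ m) (^-split s≤2n∸1) ⟩
    p ^ (2 * n ∸ 1) ∸ p ^ s * p ^ m                ≡⟨ cong (λ e → p ^ e ∸ p ^ s * p ^ m) 2n∸1≡n+m ⟩
    p ^ (n + m) ∸ p ^ s * p ^ m                    ≡⟨ cong (_∸ p ^ s * p ^ m) (^-distribˡ-+-* p n m) ⟩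
    p ^ n * p ^ m ∸ p ^ s * p ^ m                  ≡⟨ *-distribʳ-∸ (p ^ m) (p ^ n) (p ^ s) ⟨
    (p ^ n ∸ p ^ s) * p ^ m                        ∎
    where open ≡-Reasoning

  β-scaled : p ^ s * β ≡ p ^ s * (p ^ n * 1) + (p ^ n ∸ p ^ s) * p ^ m
  β-scaled = begin
    p ^ s * (p ^ n + p ^ (2 * n ∸ 1 ∸ s) ∸ p ^ m)     ≡⟨ cong (p ^ s *_) (+-∸-assoc (p ^ n) p^m≤p^[2n∸1∸s]) ⟩
    p ^ s * (p ^ n + α)                               ≡⟨ *-distribˡ-+ (p ^ s) (p ^ n) α ⟩
    p ^ s * p ^ n + p ^ s * α                         ≡⟨ cong₂ _+_ (cong (p ^ s *_) (sym (*-identityʳ (p ^ n)))) α-scaled ⟩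
    p ^ s * (p ^ n * 1) + (p ^ n ∸ p ^ s) * p ^ m     ∎
    where open ≡-Reasoning

  pairs-off : ∀ i z → on (block i) z ≡ false → pairs i z ≡ α
  pairs-off i z off = *-cancelˡ-≡ _ _ (p ^ s) {{m^n≢0 p s}} (begin
    p ^ s * pairs i z                                               ≡⟨ pairs-value i z ⟩
    p ^ s * (p ^ n * ind (on (block i) z)) + (p ^ n ∸ p ^ s) * p ^ m ≡⟨ cong (λ b → p ^ s * (p ^ n * ind b) + (p ^ n ∸ p ^ s) * p ^ m) off ⟩
    p ^ s * (p ^ n * 0) + (p ^ n ∸ p ^ s) * p ^ m                    ≡⟨ cong (λ k → p ^ s * k + (p ^ n ∸ p ^ s) * p ^ m) (*-zeroʳ (p ^ n)) ⟩
    p ^ s * 0 + (p ^ n ∸ p ^ s) * p ^ m                              ≡⟨ cong (_+ (p ^ n ∸ p ^ s) * p ^ m) (*-zeroʳ (p ^ s)) ⟩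
    (p ^ n ∸ p ^ s) * p ^ m                                          ≡⟨ α-scaled ⟨
    p ^ s * α                                                        ∎)
    where open ≡-Reasoning

  pairs-on : ∀ i z → on (block i) z ≡ true → pairs i z ≡ β
  pairs-on i z on = *-cancelˡ-≡ _ _ (p ^ s) {{m^n≢0 p s}}
    (trans (subst (λ b → p ^ s * pairs i z ≡ p ^ s * (p ^ n * ind b) + (p ^ n ∸ p ^ s) * p ^ m) on (pairs-value i z))
           (sym β-scaled))

  Conclusion : ℕ → Set
  Conclusion b = Σ (Fin b → Point p n) λ rep →
    EnumeratesTranslates p f b rep × IsPGD p n f b rep (p ^ (n + 1)) (p ^ n) (p ^ (n ∸ s)) α β

  design : Conclusion (length reps)
  design = block , (classRep-distinct , classRep-cover)
    , (trans (length-allPoints n) ^-suc , block-size , replication , λ z i → pairs-off i z , pairs-on i z)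


-- A prime p is at least 2 and n ≥ 1, so Design applies; its blocks are p^(n+1-s) in number.
mainTheorem10 : (p : ℕ) .{{_ : NonZero p}} → Prime p → (n : ℕ) → 1 ≤ n →
    (f : V p n → Fp p) → PartiallyBent p n f → (s : ℕ) → LinearSpaceDim p n f s →
    Σ (Fin (p ^ (n + 1 ∸ s)) → Point p n) λ rep →
      EnumeratesTranslates p f (p ^ (n + 1 ∸ s)) rep
      × IsPGD p n f (p ^ (n + 1 ∸ s)) rep
          (p ^ (n + 1)) (p ^ n) (p ^ (n ∸ s))
          (p ^ (2 * n ∸ 1 ∸ s) ∸ p ^ (n ∸ 1))
          (p ^ n + p ^ (2 * n ∸ 1 ∸ s) ∸ p ^ (n ∸ 1))
mainTheorem10 p p-prime n 1≤n f pb s ld with nonTrivial⇒n>1 p {{prime⇒nonTrivial p-prime}} | 1≤n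
... | s≤s (s≤s {n = q} _) | s≤s {n = m} _ = subst Conclusion block-count design
  where open Design q m f pb s ld
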